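{- Let $A$ be a totally ordered alphabet, $u\in A^*$ and $b,\ell\in A$ with $b>\ell$. Suppose that $\rho_\ell(u)$ is positive (i.e. lies in $A^*$), and that $u$ has a factor $\pi b$ where $\pi$ is a nonempty palindrome. Then $\rho_\ell(\pi)\ell^{ -1}$ is a positive palindrome, i.e. an element of $A^*$ which is a palindrome.
   Context: $F(A)$ is the free group on $A$ and $A^*\subset F(A)$ the free monoid; elements of $A^*$ are called positive. The reversal is the anti-automorphism of $F(A)$ fixing every letter; a palindrome is an element fixed by it. $\rho_\ell$ is the automorphism of $F(A)$ defined on letters $a\in A$ by $\rho_\ell(a)=a\ell$ if $a<\ell$, $\rho_\ell(\ell)=\ell$, and $\rho_\ell(a)=\ell^{ -1}a$ if $a>\ell$. -}

module Defs where

open import Level using (0ℓ)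
open import Data.Bool using (Bool; true; false; if_then_else_)
open import Data.List using (List; []; _∷_; _++_; map; reverse; foldr; concatMap)
open import Data.Product using (∃; _×_)
open import Relation.Binary.Core using (Rel)
open import Relation.Binary.Structures using (IsStrictTotalOrder)
open import Relation.Binary.Definitions using (tri<; tri≈; tri>)
open import Relation.Binary.PropositionalEquality using (_≡_)
open import Relation.Nullary.Decidable using (⌊_⌋)

-- Letters of the free group F(A): a generator or its inverse.
-- A word in List (Letter A) represents an element of F(A).
data Letter (A : Set) : Set where
  pos : A → Letter A
  neg : A → Letter A

module _ {A : Set} {_<_ : Rel A 0ℓ} (sto : IsStrictTotalOrder _≡_ _<_) where
  open IsStrictTotalOrder sto using (compare; _≟_)

  cancels : Letter A → Letter A → Bool
  cancels (pos a) (neg b) = ⌊ a ≟ b ⌋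
  cancels (neg a) (pos b) = ⌊ a ≟ b ⌋
  cancels _ _ = false

  push : Letter A → List (Letter A) → List (Letter A)
  push x [] = x ∷ []
  push x (y ∷ ys) = if cancels x y then ys else x ∷ y ∷ ys

  reduce : List (Letter A) → List (Letter A)
  reduce = foldr push []

  ρLetter : A → Letter A → List (Letter A)
  ρLetter ℓ (pos a) with compare a ℓ
  ... | tri< _ _ _ = pos a ∷ pos ℓ ∷ []
  ... | tri≈ _ _ _ = pos ℓ ∷ []
  ... | tri> _ _ _ = neg ℓ ∷ pos a ∷ []
  ρLetter ℓ (neg a) with compare a ℓ
  ... | tri< _ _ _ = neg ℓ ∷ neg a ∷ []
  ... | tri≈ _ _ _ = neg ℓ ∷ []
  ... | tri> _ _ _ = neg a ∷ pos ℓ ∷ []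

  ρ : A → List (Letter A) → List (Letter A)
  ρ ℓ w = concatMap (ρLetter ℓ) w

  IsPositive : List (Letter A) → Set
  IsPositive w = ∃ λ (v : List A) → reduce w ≡ map pos v

  -- the element represented by w is a palindrome: reversal (the anti-automorphism
  -- fixing letters, which reverses a reduced word keeping exponents) fixes it
  IsPalindrome : List (Letter A) → Set
  IsPalindrome w = reverse (reduce w) ≡ reduce w

-- Under ρ_ℓ a letter c ≤ ℓ ends with ℓ and a letter c > ℓ starts with ℓ⁻¹, so ρ_ℓ of a
-- positive word reduces to an explicit normal form which is positive exactly when no two
-- adjacent letters exceed ℓ.  The normal form is compatible with reversal, so a palindrome π
-- has a palindromic normal form; since b > ℓ follows π in u, the last (hence also the first)
-- letter of π is ≤ ℓ, and then the normal form of ρ_ℓ(π)ℓ⁻¹ contains no ℓ⁻¹.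
module Submission where

open import Defs
open import Level using (0ℓ)
open import Data.Bool using (Bool; true; false)
open import Data.Empty using (⊥)
open import Data.List using (List; []; _∷_; _++_; map; reverse)
open import Data.List.Properties using (++-assoc; ++-identityʳ; reverse-++; unfold-reverse)
open import Data.List.Relation.Unary.All using (All; []; _∷_; universal)
open import Data.List.Relation.Unary.All.Properties using (++⁺; ++⁻ˡ; ++⁻ʳ; map⁺)
open import Data.Product using (_×_; _,_; ∃)
open import Data.Unit using (⊤; tt)
open import Relation.Binary.Core using (Rel)
open import Relation.Binary.Structures using (IsStrictTotalOrder)
open import Relation.Binary.Definitions using (tri<; tri≈; tri>)
open import Relation.Binary.PropositionalEquality
  using (_≡_; _≢_; ≢-sym; refl; sym; trans; cong; subst; module ≡-Reasoning)
open import Relation.Nullary using (yes; no; contradiction)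

Positive : {A : Set} → Letter A → Set
Positive (pos _) = ⊤
Positive (neg _) = ⊥

positive-map-pos : {A : Set} (v : List A) → All Positive (map pos v)
positive-map-pos v = map⁺ (universal (λ _ → tt) v)

positive⇒map-pos : {A : Set} {ws : List (Letter A)} → All Positive ws → ∃ λ v → ws ≡ map pos v
positive⇒map-pos [] = [] , refl
positive⇒map-pos {ws = pos a ∷ _} (_ ∷ ps) with positive⇒map-pos ps
... | v , refl = a ∷ v , refl

All-reverse : {A : Set} {P : A → Set} {xs : List A} → All P xs → All P (reverse xs)
All-reverse [] = []
All-reverse {xs = x ∷ xs} (p ∷ ps) rewrite unfold-reverse x xs = ++⁺ (All-reverse ps) (p ∷ [])

module _ {A : Set} {_<_ : Rel A 0ℓ} (sto : IsStrictTotalOrder _≡_ _<_) where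
  open IsStrictTotalOrder sto using (_≟_)

  push-cancel : ∀ a ys → push sto (pos a) (neg a ∷ ys) ≡ ys
  push-cancel a ys with a ≟ a
  ... | yes _ = refl
  ... | no a≢a = contradiction refl a≢a

  push-pos-neg : ∀ {a b} → a ≢ b → ∀ ys → push sto (pos a) (neg b ∷ ys) ≡ pos a ∷ neg b ∷ ys
  push-pos-neg {a} {b} a≢b ys with a ≟ b
  ... | yes a≡b = contradiction a≡b a≢b
  ... | no _ = refl

  push-neg-pos : ∀ {a b} → a ≢ b → ∀ ys → push sto (neg a) (pos b ∷ ys) ≡ neg a ∷ pos b ∷ ys
  push-neg-pos {a} {b} a≢b ys with a ≟ b
  ... | yes a≡b = contradiction a≡b a≢b
  ... | no _ = refl

-- For a positive word w, ρ_ℓ(w) freely reduces to: each letter of w other than ℓ,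
-- and between two adjacent letters the letter ℓ if both are ≤ ℓ, ℓ⁻¹ if both are > ℓ,
-- nothing otherwise (the ℓ ending the image of c ≤ ℓ cancels the ℓ⁻¹ starting that of c' > ℓ).
-- NF p w e is this word when w sits between a letter that is ≤ ℓ iff p and one that is ≤ ℓ iff e.
module NormalForm {A : Set} {_<_ : Rel A 0ℓ} (sto : IsStrictTotalOrder _≡_ _<_) (ℓ : A) where
  open IsStrictTotalOrder sto using (compare)
  open ≡-Reasoning

  small : A → Bool
  small c with compare c ℓ
  ... | tri< _ _ _ = true
  ... | tri≈ _ _ _ = true
  ... | tri> _ _ _ = false

  small-above : ∀ {c} → ℓ < c → small c ≡ false
  small-above {c} ℓ<c with compare c ℓ
  ... | tri< _ _ ℓ≮c = contradiction ℓ<c ℓ≮c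
  ... | tri≈ _ _ ℓ≮c = contradiction ℓ<c ℓ≮c
  ... | tri> _ _ _ = refl

  kept : A → List (Letter A)
  kept c with compare c ℓ
  ... | tri< _ _ _ = pos c ∷ []
  ... | tri≈ _ _ _ = []
  ... | tri> _ _ _ = pos c ∷ []

  junction : Bool → Bool → List (Letter A)
  junction true true = pos ℓ ∷ []
  junction false false = neg ℓ ∷ []
  junction _ _ = []

  firstSmall : List A → Bool → Bool
  firstSmall [] e = e
  firstSmall (c ∷ _) _ = small c

  body : List A → Bool → List (Letter A)
  body [] e = []
  body (c ∷ w) e = kept c ++ junction (small c) (firstSmall w e) ++ body w e

  NF : Bool → List A → Bool → List (Letter A)
  NF p w e = junction p (firstSmall w e) ++ body w e

  push-pos-body : ∀ a w e → push sto (pos a) (body w e) ≡ pos a ∷ body w e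
  push-pos-body a [] e = refl
  push-pos-body a (c ∷ w) e with compare c ℓ | firstSmall w e
  ... | tri< _ _ _ | _ = refl
  ... | tri≈ _ _ _ | true = refl
  ... | tri≈ _ _ _ | false = push-pos-body a w e
  ... | tri> _ _ _ | _ = refl

  push-pos-NF : ∀ {a} → a ≢ ℓ → ∀ p w e → push sto (pos a) (NF p w e) ≡ pos a ∷ NF p w e
  push-pos-NF a≢ℓ p w e with p | firstSmall w e
  ... | true | true = refl
  ... | true | false = push-pos-body _ w e
  ... | false | true = push-pos-body _ w e
  ... | false | false = push-pos-neg sto a≢ℓ (body w e)

  push-ℓ-NF : ∀ w e → push sto (pos ℓ) (NF false w e) ≡ NF true w e
  push-ℓ-NF w e with firstSmall w e
  ... | true = push-pos-body ℓ w e
  ... | false = push-cancel sto ℓ (body w e)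

  -- junction false e is the empty word, or the ℓ⁻¹ that begins the image of a following letter > ℓ.
  reduce-ρ : ∀ w e → reduce sto (ρ sto ℓ (map pos w) ++ junction false e) ≡ NF false w e
  reduce-ρ [] true = refl
  reduce-ρ [] false = refl
  reduce-ρ (c ∷ w) e with compare c ℓ
  ... | tri< _ c≢ℓ _ = begin
    push sto (pos c) (push sto (pos ℓ) (reduce sto (ρ sto ℓ (map pos w) ++ junction false e)))
      ≡⟨ cong (λ r → push sto (pos c) (push sto (pos ℓ) r)) (reduce-ρ w e) ⟩
    push sto (pos c) (push sto (pos ℓ) (NF false w e))
      ≡⟨ cong (push sto (pos c)) (push-ℓ-NF w e) ⟩
    push sto (pos c) (NF true w e)
      ≡⟨ push-pos-NF c≢ℓ true w e ⟩
    pos c ∷ NF true w e ∎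
  ... | tri≈ _ refl _ = trans (cong (push sto (pos ℓ)) (reduce-ρ w e)) (push-ℓ-NF w e)
  ... | tri> _ c≢ℓ ℓ<c = begin
    push sto (neg ℓ) (push sto (pos c) (reduce sto (ρ sto ℓ (map pos w) ++ junction false e)))
      ≡⟨ cong (λ r → push sto (neg ℓ) (push sto (pos c) r)) (reduce-ρ w e) ⟩
    push sto (neg ℓ) (push sto (pos c) (NF false w e))
      ≡⟨ cong (push sto (neg ℓ)) (push-pos-NF c≢ℓ false w e) ⟩
    push sto (neg ℓ) (pos c ∷ NF false w e)
      ≡⟨ push-neg-pos sto (≢-sym c≢ℓ) (NF false w e) ⟩
    neg ℓ ∷ pos c ∷ NF false w e ∎

  firstSmall-++ : ∀ w z e → firstSmall (w ++ z) e ≡ firstSmall w (firstSmall z e)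
  firstSmall-++ [] z e = refl
  firstSmall-++ (c ∷ w) z e = refl

  firstSmall-nonempty : ∀ {w} → w ≢ [] → ∀ e e′ → firstSmall w e ≡ firstSmall w e′
  firstSmall-nonempty {[]} w≢[] _ _ = contradiction refl w≢[]
  firstSmall-nonempty {c ∷ w} _ _ _ = refl

  body-++ : ∀ w z e → body (w ++ z) e ≡ body w (firstSmall z e) ++ body z e
  body-++ [] z e = refl
  body-++ (c ∷ w) z e = begin
    kept c ++ junction (small c) (firstSmall (w ++ z) e) ++ body (w ++ z) e
      ≡⟨ cong (λ s → kept c ++ junction (small c) s ++ body (w ++ z) e) (firstSmall-++ w z e) ⟩
    kept c ++ junction (small c) s ++ body (w ++ z) e
      ≡⟨ cong (λ r → kept c ++ junction (small c) s ++ r) (body-++ w z e) ⟩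
    kept c ++ junction (small c) s ++ body w (firstSmall z e) ++ body z e
      ≡⟨ cong (kept c ++_) (sym (++-assoc (junction (small c) s) _ _)) ⟩
    kept c ++ (junction (small c) s ++ body w (firstSmall z e)) ++ body z e
      ≡⟨ sym (++-assoc (kept c) _ _) ⟩
    (kept c ++ junction (small c) s ++ body w (firstSmall z e)) ++ body z e ∎
    where s = firstSmall w (firstSmall z e)

  NF-snoc : ∀ p w c e → NF p (w ++ c ∷ []) e ≡ NF p w (small c) ++ kept c ++ junction (small c) e
  NF-snoc p w c e = begin
    junction p (firstSmall (w ++ c ∷ []) e) ++ body (w ++ c ∷ []) e
      ≡⟨ cong (λ s → junction p s ++ body (w ++ c ∷ []) e) (firstSmall-++ w (c ∷ []) e) ⟩
    junction p (firstSmall w (small c)) ++ body (w ++ c ∷ []) e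
      ≡⟨ cong (junction p (firstSmall w (small c)) ++_) (body-++ w (c ∷ []) e) ⟩
    junction p (firstSmall w (small c)) ++ body w (small c) ++ kept c ++ junction (small c) e ++ []
      ≡⟨ sym (++-assoc (junction p (firstSmall w (small c))) _ _) ⟩
    NF p w (small c) ++ kept c ++ junction (small c) e ++ []
      ≡⟨ cong (λ r → NF p w (small c) ++ kept c ++ r) (++-identityʳ (junction (small c) e)) ⟩
    NF p w (small c) ++ kept c ++ junction (small c) e ∎

  reverse-junction : ∀ p q → reverse (junction p q) ≡ junction q p
  reverse-junction true true = refl
  reverse-junction true false = refl
  reverse-junction false true = refl
  reverse-junction false false = refl

  reverse-kept : ∀ c → reverse (kept c) ≡ kept c
  reverse-kept c with compare c ℓ
  ... | tri< _ _ _ = refl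
  ... | tri≈ _ _ _ = refl
  ... | tri> _ _ _ = refl

  reverse-NF : ∀ p w e → reverse (NF p w e) ≡ NF e (reverse w) p
  reverse-NF p [] e rewrite ++-identityʳ (junction p e) | ++-identityʳ (junction e p) =
    reverse-junction p e
  reverse-NF p (c ∷ w) e = begin
    reverse (junction p (small c) ++ kept c ++ NF (small c) w e)
      ≡⟨ reverse-++ (junction p (small c)) _ ⟩
    reverse (kept c ++ NF (small c) w e) ++ reverse (junction p (small c))
      ≡⟨ cong (_++ reverse (junction p (small c))) (reverse-++ (kept c) _) ⟩
    (reverse (NF (small c) w e) ++ reverse (kept c)) ++ reverse (junction p (small c))
      ≡⟨ ++-assoc (reverse (NF (small c) w e)) _ _ ⟩
    reverse (NF (small c) w e) ++ reverse (kept c) ++ reverse (junction p (small c))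
      ≡⟨ cong (λ r → reverse (NF (small c) w e) ++ r ++ reverse (junction p (small c))) (reverse-kept c) ⟩
    reverse (NF (small c) w e) ++ kept c ++ reverse (junction p (small c))
      ≡⟨ cong (λ r → reverse (NF (small c) w e) ++ kept c ++ r) (reverse-junction p (small c)) ⟩
    reverse (NF (small c) w e) ++ kept c ++ junction (small c) p
      ≡⟨ cong (_++ kept c ++ junction (small c) p) (reverse-NF (small c) w e) ⟩
    NF e (reverse w) (small c) ++ kept c ++ junction (small c) p
      ≡⟨ sym (NF-snoc e (reverse w) c p) ⟩
    NF e (reverse w ++ c ∷ []) p
      ≡⟨ cong (λ v → NF e v p) (sym (unfold-reverse c w)) ⟩
    NF e (reverse (c ∷ w)) p ∎

  NF-palindrome : ∀ {w} → reverse w ≡ w → ∀ p → reverse (NF p w p) ≡ NF p w p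
  NF-palindrome {w} w-pal p = trans (reverse-NF p w p) (cong (λ v → NF p v p) w-pal)

  junction-true-positive : ∀ q → All Positive (junction true q)
  junction-true-positive true = tt ∷ []
  junction-true-positive false = []

  body-infix-positive : ∀ {p} x w z {e} → All Positive (NF p (x ++ w ++ z) e)
    → All Positive (body w (firstSmall z e))
  body-infix-positive {p} x w z {e} nf⁺ =
    ++⁻ˡ (body w (firstSmall z e)) (subst (All Positive) (body-++ w z e)
      (++⁻ʳ (body x _) (subst (All Positive) (body-++ x (w ++ z) e)
        (++⁻ʳ (junction p _) nf⁺))))

  -- The reversal of NF true w false is NF false w true, so for a palindrome w the
  -- positivity of body w false forces the first letter of w to be ≤ ℓ.
  palindrome-NF-positive : ∀ {w} → reverse w ≡ w → w ≢ [] → All Positive (body w false)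
    → All Positive (NF false w false)
  palindrome-NF-positive {w} w-pal w≢[] body⁺ = ++⁺ first⁺ body⁺
    where
    reversed⁺ : All Positive (NF false w true)
    reversed⁺ = subst (All Positive) (trans (reverse-NF true w false) (cong (λ v → NF false v true) w-pal))
      (All-reverse (++⁺ (junction-true-positive (firstSmall w false)) body⁺))

    first⁺ : All Positive (junction false (firstSmall w false))
    first⁺ = subst (λ s → All Positive (junction false s)) (firstSmall-nonempty w≢[] true false)
      (++⁻ˡ (junction false (firstSmall w true)) reversed⁺)

lemma6 : {A : Set} {_<_ : Rel A 0ℓ} (sto : IsStrictTotalOrder _≡_ _<_)
    (u : List A) (b ℓ : A) → ℓ < b
    → IsPositive sto (ρ sto ℓ (map pos u))
    → (x π y : List A) → u ≡ x ++ π ++ b ∷ y → π ≢ [] → reverse π ≡ π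
    → IsPositive sto (ρ sto ℓ (map pos π) ++ neg ℓ ∷ [])
      × IsPalindrome sto (ρ sto ℓ (map pos π) ++ neg ℓ ∷ [])
lemma6 sto u b ℓ ℓ<b (v , ρu≡v) x π y refl π≢[] π-pal = positive , palindrome
  where
  open NormalForm sto ℓ

  reduced : reduce sto (ρ sto ℓ (map pos π) ++ neg ℓ ∷ []) ≡ NF false π false
  reduced = reduce-ρ π false

  u-positive : All Positive (NF false u true)
  u-positive = subst (All Positive)
    (trans (sym ρu≡v) (trans (cong (reduce sto) (sym (++-identityʳ (ρ sto ℓ (map pos u))))) (reduce-ρ u true)))
    (positive-map-pos v)

  π-positive : All Positive (NF false π false)
  π-positive = palindrome-NF-positive π-pal π≢[]
    (subst (λ s → All Positive (body π s)) (small-above ℓ<b) (body-infix-positive x π (b ∷ y) u-positive))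

  positive : IsPositive sto (ρ sto ℓ (map pos π) ++ neg ℓ ∷ [])
  positive with positive⇒map-pos π-positive
  ... | w , NF≡w = w , trans reduced NF≡w

  palindrome : IsPalindrome sto (ρ sto ℓ (map pos π) ++ neg ℓ ∷ [])
  palindrome = subst (λ r → reverse r ≡ r) (sym reduced) (NF-palindrome π-pal false)
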